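{- Let $H$ be a bipartite graph. Let $k_1$ be the largest positive integer such that every bipartition of $H$ has a part of size at least $k_1$ (i.e. $k_1=\min\max\{|X|,|Y|\}$ over all bipartitions $(X,Y)$ of $H$), and let $k_2$ be the largest positive integer such that every bipartition of $H$ has both parts of size at least $k_2$ (i.e. $k_2=\min\min\{|X|,|Y|\}$ over all bipartitions $(X,Y)$ of $H$). Let $G$ be an $n$-vertex graph with chromatic number $\chi$ and independence number $\alpha$. If $k_2 \geq 3$, then \[ \chi_H(G) \leq \min\left\{ \frac{n}{k_1-1} + \frac{k_1-2}{k_1-1}\,\chi,\ \frac{n}{k_2-1}\left(1-\frac{1}{\chi}\right) + \frac{k_2-2}{k_2-1}(\chi-1) + 1 \right\}. \] If $k_2 = 2$, then \[ \chi_H(G) \leq \min\left\{ \frac{n}{k_1-1} + \frac{k_1-2}{k_1-1}\,\chi,\ n-\alpha+1 \right\}. \]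
   Context: All graphs are finite and simple. A bipartition of a bipartite graph $H$ is a partition of $V(H)$ into two independent sets $X,Y$. For a fixed bipartite graph $H$, a proper vertex coloring of a graph $G$ is called an $H$-avoiding coloring if for any two color classes, the subgraph of $G$ induced by their union contains no induced subgraph isomorphic to $H$. $\chi_H(G)$ denotes the minimum number of colors in an $H$-avoiding coloring of $G$. -}

module Defs where

open import Data.Nat using (ℕ; _≤_; _⊔_; _⊓_)
open import Data.Fin using (Fin)
open import Data.Fin.Subset using (Subset; _∈_; ∁; ∣_∣)
open import Data.Product using (Σ; _×_; ∃; ∃-syntax)
open import Relation.Nullary using (¬_)
open import Relation.Binary using (Decidable)
open import Relation.Binary.PropositionalEquality using (_≡_; _≢_)
open import Function.Definitions using (Injective)
open import Function.Bundles using (_⇔_)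

record Graph (n : ℕ) : Set₁ where
  field
    Adj    : Fin n → Fin n → Set
    adj?   : Decidable Adj
    sym    : ∀ {u v} → Adj u v → Adj v u
    irrefl : ∀ {u} → ¬ Adj u u
open Graph public

Independent : ∀ {n} → Graph n → Subset n → Set
Independent G S = ∀ {u v} → u ∈ S → v ∈ S → ¬ Adj G u v

IsBipartition : ∀ {h} → Graph h → Subset h → Set
IsBipartition H X = Independent H X × Independent H (∁ X)

IsK₁ : ∀ {h} → Graph h → ℕ → Set
IsK₁ H k = (∀ X → IsBipartition H X → k ≤ ∣ X ∣ ⊔ ∣ ∁ X ∣)
         × (∃[ X ] (IsBipartition H X × ∣ X ∣ ⊔ ∣ ∁ X ∣ ≡ k))

IsK₂ : ∀ {h} → Graph h → ℕ → Set
IsK₂ H k = (∀ X → IsBipartition H X → k ≤ ∣ X ∣ ⊓ ∣ ∁ X ∣)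
         × (∃[ X ] (IsBipartition H X × ∣ X ∣ ⊓ ∣ ∁ X ∣ ≡ k))

Proper : ∀ {n c} → Graph n → (Fin n → Fin c) → Set
Proper G col = ∀ {u v} → Adj G u v → col u ≢ col v

IsChromaticNumber : ∀ {n} → Graph n → ℕ → Set
IsChromaticNumber {n} G χ =
  (Σ (Fin n → Fin χ) (Proper G))
  × (∀ m → Σ (Fin n → Fin m) (Proper G) → χ ≤ m)

IsIndependenceNumber : ∀ {n} → Graph n → ℕ → Set
IsIndependenceNumber {n} G α =
  (∃[ S ] (Independent G S × ∣ S ∣ ≡ α))
  × (∀ S → Independent G S → ∣ S ∣ ≤ α)

InducedCopyIn : ∀ {h n} → Graph h → Graph n → (Fin n → Set) → Set
InducedCopyIn {h} {n} H G P =
  Σ (Fin h → Fin n) λ f →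
    Injective _≡_ _≡_ f × (∀ a → P (f a)) × (∀ a b → Adj H a b ⇔ Adj G (f a) (f b))

HAvoiding : ∀ {h n c} → Graph h → Graph n → (Fin n → Fin c) → Set
HAvoiding {c = c} H G col =
  Proper G col ×
  (∀ (i j : Fin c) → i ≢ j →
     ¬ InducedCopyIn H G (λ v → (col v ≡ i) Data.Sum.⊎ (col v ≡ j)))
  where import Data.Sum

-- Refine a proper colouring by cutting its colour classes into pieces. An induced copy of H
-- inside the union of two refined classes is split by them into a bipartition (X , ∁ X) of H,
-- each part injecting into one piece. Cutting every class into pieces of at most k₁ − 1 vertices
-- thus forces max{|X|,|∁X|} < k₁, which is impossible, with Σₐ ⌈|Vₐ|/(k₁−1)⌉ colours. To force
-- min{|X|,|∁X|} < k₂ it suffices to cut all classes but one into pieces of at most k₂ − 1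
-- vertices: keeping a largest colour class (of size at least n/χ) whole gives the second bound,
-- and for k₂ = 2 keeping a maximum independent set whole and making every other vertex its own
-- class gives n − α + 1 colours.

module Submission where

open import Defs hiding (sym)
open import Data.Nat using (ℕ; zero; suc; pred; _≤_; _<_; _+_; _*_; _∸_; z≤n; s≤s; s≤s⁻¹; NonZero)
open import Data.Nat.Properties hiding (_≟_; suc-injective)
open import Data.Nat.DivMod using (_/_; _%_; m≡m%n+[m/n]*n; m%n<n; m/n*n≤m; m<n*o⇒m/o<n; m<n⇒m/n≡0)
open import Data.Nat.Tactic.RingSolver using (solve-∀)
open import Algebra.Properties.Semiring.Sum +-*-semiring
  using (sum; sum-remove; sum-replicate-zero; *-distribʳ-sum)
open import Algebra.Properties.CommutativeSemigroup +-commutativeSemigroup using (interchange)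
open import Data.Bool using (true; false; if_then_else_)
open import Data.Fin using (Fin; zero; suc; toℕ; fromℕ<; punchIn; _≟_)
open import Data.Fin.Properties
  using (suc-injective; toℕ-fromℕ<; toℕ-injective; fromℕ<-injective; injective⇒≤; punchInᵢ≢i; any?)
open import Data.Fin.Subset using (Subset; _∈_; ∁; ∣_∣)
open import Data.Fin.Subset.Properties using (x∈∁p⇒x∉p)
open import Data.Vec using (_∷_; []; lookup; tabulate; here; there)
open import Data.Vec.Properties using ([]=⇒lookup; lookup⇒[]=; lookup∘tabulate)
open import Data.Vec.Functional using (removeAt)
open import Data.List using (allFin)
open import Data.List.Extrema.Nat using (argmax; f[xs]≤f[argmax])
open import Data.List.Membership.Propositional.Properties using (∈-allFin)
import Data.List.Relation.Unary.All as All
open import Data.Product using (Σ; _×_; _,_; proj₁; proj₂; ∃-syntax)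
open import Data.Sum using (_⊎_; inj₁; inj₂; [_,_]′)
open import Data.Unit using (⊤)
open import Function using (_∘_; id; it)
open import Function.Bundles using (Equivalence)
open import Function.Definitions using (Injective)
open import Relation.Nullary using (Dec; yes; no; does; ¬_; contradiction)
open import Relation.Nullary.Decidable using (dec-true; dec-false; _×-dec_)
open import Relation.Binary.PropositionalEquality

⌈_/_⌉ : ℕ → (d : ℕ) → {{NonZero d}} → ℕ
⌈ m / d ⌉ = (m + pred d) / d

m≤⌈m/d⌉*d : ∀ m d {{_ : NonZero d}} → m ≤ ⌈ m / d ⌉ * d
m≤⌈m/d⌉*d m d = +-cancelʳ-≤ (pred d) m _ (begin
  m + pred d                       ≡⟨ m≡m%n+[m/n]*n (m + pred d) d ⟩
  (m + pred d) % d + ⌈ m / d ⌉ * d ≤⟨ +-monoˡ-≤ _ (<⇒≤pred (m%n<n (m + pred d) d)) ⟩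
  pred d + ⌈ m / d ⌉ * d           ≡⟨ +-comm (pred d) _ ⟩
  ⌈ m / d ⌉ * d + pred d           ∎)
  where open ≤-Reasoning

⌈m/d⌉*d≤m+pred[d] : ∀ m d {{_ : NonZero d}} → ⌈ m / d ⌉ * d ≤ m + pred d
⌈m/d⌉*d≤m+pred[d] m d = m/n*n≤m (m + pred d) d

m≤d⇒⌈m/d⌉≤1 : ∀ {m d} {{_ : NonZero d}} → m ≤ d → ⌈ m / d ⌉ ≤ 1
m≤d⇒⌈m/d⌉≤1 {m} {suc d} m≤d = s≤s⁻¹ (m<n*o⇒m/o<n (begin-strict
  m + d             <⟨ +-mono-≤-< m≤d (n<1+n d) ⟩
  suc d + suc d     ≡⟨ cong (suc d +_) (sym (+-identityʳ (suc d))) ⟩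
  2 * suc d         ∎))
  where open ≤-Reasoning

sum-mono-≤ : ∀ {k} {f g : Fin k → ℕ} → (∀ a → f a ≤ g a) → sum f ≤ sum g
sum-mono-≤ {zero}  f≤g = z≤n
sum-mono-≤ {suc k} f≤g = +-mono-≤ (f≤g zero) (sum-mono-≤ (f≤g ∘ suc))

sum-+ : ∀ {k} (f g : Fin k → ℕ) → sum (λ a → f a + g a) ≡ sum f + sum g
sum-+ {zero}  f g = refl
sum-+ {suc k} f g = trans (cong (f zero + g zero +_) (sum-+ (f ∘ suc) (g ∘ suc)))
                          (interchange (f zero) (g zero) (sum (f ∘ suc)) (sum (g ∘ suc)))

sum-const : ∀ k x → sum {k} (λ _ → x) ≡ k * x
sum-const zero    x = refl
sum-const (suc k) x = cong (x +_) (sum-const k x)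

offset : ∀ {k} → (Fin k → ℕ) → Fin k → ℕ
offset p zero    = 0
offset p (suc a) = p zero + offset (p ∘ suc) a

offset+<sum : ∀ {k} (p : Fin k → ℕ) a {q} → q < p a → offset p a + q < sum p
offset+<sum p zero    q<p = <-≤-trans q<p (m≤m+n (p zero) _)
offset+<sum p (suc a) {q} q<p = begin-strict
  p zero + offset (p ∘ suc) a + q   ≡⟨ +-assoc (p zero) _ q ⟩
  p zero + (offset (p ∘ suc) a + q) <⟨ +-monoʳ-< (p zero) (offset+<sum (p ∘ suc) a q<p) ⟩
  p zero + sum (p ∘ suc)            ∎
  where open ≤-Reasoning

offset+-injective : ∀ {k} (p : Fin k → ℕ) a b {q r} → q < p a → r < p b →
                    offset p a + q ≡ offset p b + r → a ≡ b
offset+-injective p zero    zero    _   _   _  = refl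
offset+-injective p zero    (suc b) q<p _   eq =
  contradiction (<-≤-trans q<p (subst (p zero ≤_) (sym eq) (≤-trans (m≤m+n (p zero) _) (m≤m+n _ _))))
                (<-irrefl refl)
offset+-injective p (suc a) zero    q<p r<p eq = sym (offset+-injective p zero (suc a) r<p q<p (sym eq))
offset+-injective p (suc a) (suc b) q<p r<p eq = cong suc (offset+-injective (p ∘ suc) a b q<p r<p
  (+-cancelˡ-≡ (p zero) _ _ (trans (sym (+-assoc (p zero) _ _)) (trans eq (+-assoc (p zero) _ _)))))

δ : ∀ {k} → Fin k → Fin k → ℕ
δ x y = if does (x ≟ y) then 1 else 0

δ-≡ : ∀ {k} {x y : Fin k} → x ≡ y → δ x y ≡ 1
δ-≡ {x = x} refl rewrite dec-true (x ≟ x) refl = refl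

sum-δ : ∀ {k} (x : Fin k) → sum (δ x) ≡ 1
sum-δ {suc k} zero    = cong suc (sum-replicate-zero k)
sum-δ         (suc x) = sum-δ x

module _ {χ : ℕ} where

  classSize : ∀ {n} → (Fin n → Fin χ) → Fin χ → ℕ
  classSize {zero}  κ a = 0
  classSize {suc n} κ a = δ (κ zero) a + classSize (κ ∘ suc) a

  rank : ∀ {n} → (Fin n → Fin χ) → Fin n → ℕ
  rank κ zero    = 0
  rank κ (suc v) = δ (κ zero) (κ (suc v)) + rank (κ ∘ suc) v

  sum-classSize : ∀ {n} (κ : Fin n → Fin χ) → sum (classSize κ) ≡ n
  sum-classSize {zero}  κ = sum-replicate-zero χ
  sum-classSize {suc n} κ = trans (sum-+ (δ (κ zero)) (classSize (κ ∘ suc)))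
                             (cong₂ _+_ (sum-δ (κ zero)) (sum-classSize (κ ∘ suc)))

  rank<classSize : ∀ {n} (κ : Fin n → Fin χ) v → rank κ v < classSize κ (κ v)
  rank<classSize κ zero    rewrite δ-≡ (refl {x = κ zero}) = s≤s z≤n
  rank<classSize κ (suc v) = +-monoʳ-< (δ (κ zero) (κ (suc v))) (rank<classSize (κ ∘ suc) v)

  rank-injective : ∀ {n} (κ : Fin n → Fin χ) {u v} → κ u ≡ κ v → rank κ u ≡ rank κ v → u ≡ v
  rank-injective κ {zero}  {zero}  _    _ = refl
  rank-injective κ {zero}  {suc v} same r =
    contradiction (trans r (cong (_+ rank (κ ∘ suc) v) (δ-≡ same))) 0≢1+n
  rank-injective κ {suc u} {zero}  same r =
    contradiction (trans (sym r) (cong (_+ rank (κ ∘ suc) u) (δ-≡ (sym same)))) 0≢1+n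
  rank-injective κ {suc u} {suc v} same r = cong suc (rank-injective (κ ∘ suc) same
    (+-cancelˡ-≡ (δ (κ zero) (κ (suc u))) _ _
      (trans r (cong (λ x → δ (κ zero) x + rank (κ ∘ suc) v) (sym same)))))

-- |{v | P v}| ≤ t, witnessed by a labelling that is injective on P.
InjectsBelow : ∀ {n} → ℕ → (Fin n → Set) → Set
InjectsBelow {n} t P =
  Σ (Fin n → ℕ) λ ℓ → (∀ {v} → P v → ℓ v < t) × (∀ {u v} → P u → P v → ℓ u ≡ ℓ v → u ≡ v)

module _ {n : ℕ} {t : ℕ} where

  injectsBelow-⊆ : ∀ {P Q : Fin n → Set} → (∀ {v} → P v → Q v) → InjectsBelow t Q → InjectsBelow t P
  injectsBelow-⊆ P⊆Q (ℓ , bound , inj) = ℓ , (λ pv → bound (P⊆Q pv)) , λ pu pv → inj (P⊆Q pu) (P⊆Q pv)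

  injectsBelow-∘ : ∀ {m} {f : Fin m → Fin n} {P : Fin n → Set} →
                   Injective _≡_ _≡_ f → InjectsBelow t P → InjectsBelow t (P ∘ f)
  injectsBelow-∘ {f = f} f-inj (ℓ , bound , inj) = ℓ ∘ f , bound , λ pu pv eq → f-inj (inj pu pv eq)

  injectsBelow-if-inhabited : ∀ {P : Fin n → Set} → (∀ v → Dec (P v)) →
                              (∀ {v} → P v → InjectsBelow t P) → InjectsBelow t P
  injectsBelow-if-inhabited P? from-member with any? P?
  ... | yes (v , pv) = from-member pv
  ... | no  empty    =
    (λ _ → 0) , (λ pv → contradiction (_ , pv) empty) , λ pu _ _ → contradiction (_ , pu) empty

injectsBelow-1⇒unique : ∀ {n} {P : Fin n → Set} → InjectsBelow 1 P → ∀ {u v} → P u → P v → u ≡ v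
injectsBelow-1⇒unique (ℓ , bound , inj) pu pv =
  inj pu pv (trans (n<1⇒n≡0 (bound pu)) (sym (n<1⇒n≡0 (bound pv))))

member : ∀ {h} (X : Subset h) → Fin ∣ X ∣ → Fin h
member (true  ∷ X) zero    = zero
member (true  ∷ X) (suc k) = suc (member X k)
member (false ∷ X) k       = suc (member X k)

member-∈ : ∀ {h} (X : Subset h) k → member X k ∈ X
member-∈ (true  ∷ X) zero    = here
member-∈ (true  ∷ X) (suc k) = there (member-∈ X k)
member-∈ (false ∷ X) k       = there (member-∈ X k)

member-injective : ∀ {h} (X : Subset h) → Injective _≡_ _≡_ (member X)
member-injective (true  ∷ X) {zero}  {zero}  _  = refl
member-injective (true  ∷ X) {suc j} {suc k} eq = cong suc (member-injective X (suc-injective eq))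
member-injective (false ∷ X)                 eq = member-injective X (suc-injective eq)

injectsBelow⇒∣p∣≤ : ∀ {h t} (X : Subset h) → InjectsBelow t (_∈ X) → ∣ X ∣ ≤ t
injectsBelow⇒∣p∣≤ X (ℓ , bound , inj) = injective⇒≤ {f = λ k → fromℕ< (bound (member-∈ X k))}
  λ eq → member-injective X (inj (member-∈ X _) (member-∈ X _) (fromℕ<-injective _ _ _ _ eq))

module _ {h : ℕ} {P : Fin h → Set} (P? : ∀ a → Dec (P a)) where

  ∈-tabulate⁻ : ∀ {a} → a ∈ tabulate (does ∘ P?) → P a
  ∈-tabulate⁻ {a} a∈ with P? a | trans (sym (lookup∘tabulate (does ∘ P?) a)) ([]=⇒lookup a∈)
  ... | yes pa | _  = pa
  ... | no  _  | ()

  ∈-tabulate⁺ : ∀ {a} → P a → a ∈ tabulate (does ∘ P?)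
  ∈-tabulate⁺ {a} pa = lookup⇒[]= a _ (trans (lookup∘tabulate (does ∘ P?) a) (dec-true (P? a) pa))

ColourClass : ∀ {n c} → (Fin n → Fin c) → Fin c → Fin n → Set
ColourClass col i v = col v ≡ i

colourClass-injectsBelow : ∀ {n c t} {col : Fin n → Fin c} {Q : Fin n → Set} →
  (∀ v → Q v → InjectsBelow t (ColourClass col (col v))) →
  ∀ i → (∀ {v} → col v ≡ i → Q v) → InjectsBelow t (ColourClass col i)
colourClass-injectsBelow {t = t} {col} small i Q-on-i =
  injectsBelow-if-inhabited (λ v → col v ≟ i) λ {v} cv≡i →
    subst (λ j → InjectsBelow t (ColourClass col j)) cv≡i (small v (Q-on-i cv≡i))

module _ {h n c} (H : Graph h) (G : Graph n) {col : Fin n → Fin c} (proper : Proper G col) where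

  copy-bipartition : ∀ {i j} → InducedCopyIn H G (λ v → col v ≡ i ⊎ col v ≡ j) →
    ∃[ X ] IsBipartition H X
         × (∀ {t} → InjectsBelow t (ColourClass col i) → ∣ X ∣ ≤ t)
         × (∀ {t} → InjectsBelow t (ColourClass col j) → ∣ ∁ X ∣ ≤ t)
  copy-bipartition {i} {j} (f , f-inj , f-into , f-adj) =
    X , (monochromatic⇒independent X⇒i , monochromatic⇒independent ∁X⇒j) ,
    (λ small → injectsBelow⇒∣p∣≤ X (injectsBelow-⊆ X⇒i (injectsBelow-∘ f-inj small))) ,
    (λ small → injectsBelow⇒∣p∣≤ (∁ X) (injectsBelow-⊆ ∁X⇒j (injectsBelow-∘ f-inj small)))
    where
    in-i? : ∀ a → Dec (col (f a) ≡ i)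
    in-i? a = col (f a) ≟ i

    X : Subset h
    X = tabulate (does ∘ in-i?)

    X⇒i : ∀ {a} → a ∈ X → col (f a) ≡ i
    X⇒i = ∈-tabulate⁻ in-i?

    ∁X⇒j : ∀ {a} → a ∈ ∁ X → col (f a) ≡ j
    ∁X⇒j {a} a∈∁X = [ (λ ci → contradiction (∈-tabulate⁺ in-i? ci) (x∈∁p⇒x∉p a∈∁X)) , id ]′ (f-into a)

    monochromatic⇒independent : ∀ {k} {S : Subset h} → (∀ {a} → a ∈ S → col (f a) ≡ k) → Independent H S
    monochromatic⇒independent S⇒k a∈S b∈S adj =
      proper (Equivalence.to (f-adj _ _) adj) (trans (S⇒k a∈S) (sym (S⇒k b∈S)))

  avoiding-k₁ : ∀ {k t} → IsK₁ H k → t < k →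
    (∀ i → InjectsBelow t (ColourClass col i)) → HAvoiding H G col
  avoiding-k₁ (k≤max , _) t<k small = proper , λ i j _ copy →
    let X , bip , ∣X∣≤ , ∣∁X∣≤ = copy-bipartition copy in
    <⇒≱ t<k (≤-trans (k≤max X bip) (⊔-lub (∣X∣≤ (small i)) (∣∁X∣≤ (small j))))

  avoiding-k₂ : ∀ {k t} → IsK₂ H k → t < k →
    (∀ i j → i ≢ j → InjectsBelow t (ColourClass col i) ⊎ InjectsBelow t (ColourClass col j)) →
    HAvoiding H G col
  avoiding-k₂ (k≤min , _) t<k small = proper , λ i j i≢j copy →
    let X , bip , ∣X∣≤ , ∣∁X∣≤ = copy-bipartition copy in
    <⇒≱ t<k (≤-trans (k≤min X bip)
      ([ (λ si → ≤-trans (m⊓n≤m _ _) (∣X∣≤ si)) , (λ sj → ≤-trans (m⊓n≤n _ _) (∣∁X∣≤ sj)) ]′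
       (small i j i≢j)))

Refines : ∀ {n c χ} → (Fin n → Fin c) → (Fin n → Fin χ) → Set
Refines col κ = ∀ {u v} → col u ≡ col v → κ u ≡ κ v

refines-proper : ∀ {n c χ} (G : Graph n) {col : Fin n → Fin c} {κ : Fin n → Fin χ} →
                 Proper G κ → Refines col κ → Proper G col
refines-proper G κ-proper refines adj same = κ-proper adj (refines same)

-- Class a is cut into pieces of cap a vertices, consecutive in rank; v lies in piece
-- rank/cap at position slot = rank mod cap, and the pieces of class a get the colours
-- offset a , … , offset a + pieces a − 1.
module Refinement {n χ} (κ : Fin n → Fin χ) (cap : Fin χ → ℕ) (cap≢0 : ∀ a → NonZero (cap a)) where

  instance
    cap-nonZero : ∀ {a} → NonZero (cap a)
    cap-nonZero {a} = cap≢0 a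

  pieces : Fin χ → ℕ
  pieces a = ⌈ classSize κ a / cap a ⌉

  piece slot : Fin n → ℕ
  piece v = rank κ v / cap (κ v)
  slot  v = rank κ v % cap (κ v)

  piece<pieces : ∀ v → piece v < pieces (κ v)
  piece<pieces v =
    m<n*o⇒m/o<n (<-≤-trans (rank<classSize κ v) (m≤⌈m/d⌉*d (classSize κ (κ v)) (cap (κ v))))

  colours : ℕ
  colours = sum pieces

  colour : Fin n → Fin colours
  colour v = fromℕ< (offset+<sum pieces (κ v) (piece<pieces v))

  toℕ-colour : ∀ v → toℕ (colour v) ≡ offset pieces (κ v) + piece v
  toℕ-colour v = toℕ-fromℕ< _

  colour-injective : ∀ {u v} → colour u ≡ colour v → κ u ≡ κ v × piece u ≡ piece v
  colour-injective {u} {v} same = κ-same , +-cancelˡ-≡ (offset pieces (κ u)) _ _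
      (trans offsets (cong (λ a → offset pieces a + piece v) (sym κ-same)))
    where
    offsets : offset pieces (κ u) + piece u ≡ offset pieces (κ v) + piece v
    offsets = trans (sym (toℕ-colour u)) (trans (cong toℕ same) (toℕ-colour v))
    κ-same : κ u ≡ κ v
    κ-same = offset+-injective pieces (κ u) (κ v) (piece<pieces u) (piece<pieces v) offsets

  colour-refines : Refines colour κ
  colour-refines = proj₁ ∘ colour-injective

  colour-class-injects : ∀ v → InjectsBelow (cap (κ v)) (ColourClass colour (colour v))
  colour-class-injects v = slot , bound , injective
    where
    bound : ∀ {u} → colour u ≡ colour v → slot u < cap (κ v)
    bound {u} same = subst (slot u <_) (cong cap (colour-refines same)) (m%n<n (rank κ u) (cap (κ u)))
    injective : ∀ {u w} → colour u ≡ colour v → colour w ≡ colour v → slot u ≡ slot w → u ≡ w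
    injective {u} {w} cu cw slots = rank-injective κ κ-same (begin
      rank κ u                     ≡⟨ m≡m%n+[m/n]*n (rank κ u) (cap (κ u)) ⟩
      slot u + piece u * cap (κ u) ≡⟨ cong₂ _+_ slots (cong₂ _*_ same-piece (cong cap κ-same)) ⟩
      slot w + piece w * cap (κ w) ≡⟨ sym (m≡m%n+[m/n]*n (rank κ w) (cap (κ w))) ⟩
      rank κ w                     ∎)
      where
      open ≡-Reasoning
      κ-same : κ u ≡ κ w
      κ-same = proj₁ (colour-injective (trans cu (sym cw)))
      same-piece : piece u ≡ piece w
      same-piece = proj₂ (colour-injective (trans cu (sym cw)))

  colour-constant-on-small-class : ∀ {a} → classSize κ a ≤ cap a →
                                   ∀ {u v} → κ u ≡ a → κ v ≡ a → colour u ≡ colour v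
  colour-constant-on-small-class {a} small {u} {v} κu≡a κv≡a = toℕ-injective (begin
    toℕ (colour u)                ≡⟨ toℕ-colour u ⟩
    offset pieces (κ u) + piece u ≡⟨ cong₂ _+_ (cong (offset pieces) (trans κu≡a (sym κv≡a)))
                                               (trans (single-piece κu≡a) (sym (single-piece κv≡a))) ⟩
    offset pieces (κ v) + piece v ≡⟨ sym (toℕ-colour v) ⟩
    toℕ (colour v)                ∎)
    where
    open ≡-Reasoning
    single-piece : ∀ {w} → κ w ≡ a → piece w ≡ 0
    single-piece {w} κw≡a =
      m<n⇒m/n≡0 (<-≤-trans (rank<classSize κ w) (subst (λ b → classSize κ b ≤ cap b) (sym κw≡a) small))

  sum-pieces*≤ : ∀ {k} (ι : Fin k → Fin χ) t → (∀ b → cap (ι b) ≡ t) →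
                 sum (pieces ∘ ι) * t ≤ sum (classSize κ ∘ ι) + k * pred t
  sum-pieces*≤ {k} ι t cap≡t = begin
    sum (pieces ∘ ι) * t                           ≡⟨ *-distribʳ-sum t (pieces ∘ ι) ⟩
    sum (λ b → pieces (ι b) * t)                   ≤⟨ sum-mono-≤ bound ⟩
    sum (λ b → classSize κ (ι b) + pred t)         ≡⟨ sum-+ (classSize κ ∘ ι) (λ _ → pred t) ⟩
    sum (classSize κ ∘ ι) + sum {k} (λ _ → pred t) ≡⟨ cong (_ +_) (sum-const k (pred t)) ⟩
    sum (classSize κ ∘ ι) + k * pred t             ∎
    where
    open ≤-Reasoning
    bound : ∀ b → pieces (ι b) * t ≤ classSize κ (ι b) + pred t
    bound b = begin
      pieces (ι b) * t                     ≡⟨ cong (pieces (ι b) *_) (sym (cap≡t b)) ⟩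
      pieces (ι b) * cap (ι b)             ≤⟨ ⌈m/d⌉*d≤m+pred[d] (classSize κ (ι b)) (cap (ι b)) ⟩
      classSize κ (ι b) + pred (cap (ι b)) ≡⟨ cong (λ c → classSize κ (ι b) + pred c) (cap≡t b) ⟩
      classSize κ (ι b) + pred t           ∎

split-uniformly : ∀ {n χ} (κ : Fin n → Fin χ) t {{_ : NonZero t}} →
  ∃[ c ] Σ (Fin n → Fin c) λ col →
    Refines col κ × (∀ i → InjectsBelow t (ColourClass col i)) × c * t ≤ n + χ * pred t
split-uniformly {n} {χ} κ t = colours , colour , colour-refines , small , count
  where
  open Refinement κ (λ _ → t) (λ _ → it)
  small : ∀ i → InjectsBelow t (ColourClass colour i)
  small i = colourClass-injectsBelow {Q = λ _ → ⊤} (λ v _ → colour-class-injects v) i _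
  count : colours * t ≤ n + χ * pred t
  count = subst (λ m → colours * t ≤ m + χ * pred t) (sum-classSize κ) (sum-pieces*≤ id t λ _ → refl)

split-keeping : ∀ {n χ} (κ : Fin n → Fin (suc χ)) a₀ t {{_ : NonZero t}} →
  ∃[ c ] Σ (Fin n → Fin c) λ col →
    Refines col κ
    × (∀ {u v} → κ u ≡ a₀ → κ v ≡ a₀ → col u ≡ col v)
    × (∀ v → κ v ≢ a₀ → InjectsBelow t (ColourClass col (col v)))
    × c * t + classSize κ a₀ ≤ t + n + χ * pred t
split-keeping {n} {χ} κ a₀ t =
  colours , colour , colour-refines , colour-constant-on-small-class small-a₀ ,
  (λ v κv≢a₀ → subst (λ c → InjectsBelow c (ColourClass colour (colour v)))
                      (cap-other κv≢a₀) (colour-class-injects v)) ,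
  count
  where
  -- No class has more than n vertices, so class a₀ stays a single piece.
  cap : Fin (suc χ) → ℕ
  cap b = if does (b ≟ a₀) then suc n else t

  cap≢0 : ∀ b → NonZero (cap b)
  cap≢0 b with does (b ≟ a₀)
  ... | true  = _
  ... | false = it

  open Refinement κ cap cap≢0

  cap-a₀ : cap a₀ ≡ suc n
  cap-a₀ rewrite dec-true (a₀ ≟ a₀) refl = refl

  cap-other : ∀ {b} → b ≢ a₀ → cap b ≡ t
  cap-other {b} b≢a₀ rewrite dec-false (b ≟ a₀) b≢a₀ = refl

  classSize-split : classSize κ a₀ + sum (removeAt (classSize κ) a₀) ≡ n
  classSize-split = trans (sym (sum-remove {i = a₀} (classSize κ))) (sum-classSize κ)

  small-a₀ : classSize κ a₀ ≤ cap a₀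
  small-a₀ = subst (classSize κ a₀ ≤_) (sym cap-a₀)
                   (m≤n⇒m≤1+n (subst (classSize κ a₀ ≤_) classSize-split (m≤m+n _ _)))

  count : colours * t + classSize κ a₀ ≤ t + n + χ * pred t
  count = begin
    colours * t + classSize κ a₀
      ≡⟨ cong (λ c → c * t + classSize κ a₀) (sum-remove {i = a₀} pieces) ⟩
    (pieces a₀ + sum (removeAt pieces a₀)) * t + classSize κ a₀
      ≡⟨ cong (_+ classSize κ a₀) (*-distribʳ-+ t (pieces a₀) _) ⟩
    pieces a₀ * t + sum (removeAt pieces a₀) * t + classSize κ a₀
      ≤⟨ +-monoˡ-≤ _ (+-mono-≤ (*-monoˡ-≤ t (m≤d⇒⌈m/d⌉≤1 {{cap≢0 a₀}} small-a₀))
                               (sum-pieces*≤ (punchIn a₀) t λ b → cap-other (punchInᵢ≢i a₀ b))) ⟩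
    1 * t + (sum (removeAt (classSize κ) a₀) + χ * pred t) + classSize κ a₀
      ≡⟨ rearrange t (sum (removeAt (classSize κ) a₀)) (χ * pred t) (classSize κ a₀) ⟩
    t + (classSize κ a₀ + sum (removeAt (classSize κ) a₀)) + χ * pred t
      ≡⟨ cong (λ m → t + m + χ * pred t) classSize-split ⟩
    t + n + χ * pred t ∎
    where
    open ≤-Reasoning
    rearrange : ∀ t r x s → 1 * t + (r + x) + s ≡ t + (s + r) + x
    rearrange = solve-∀

injects-one-of-two : ∀ {n c χ t} {col : Fin n → Fin c} (κ : Fin n → Fin χ) a₀ →
  (∀ {u v} → κ u ≡ a₀ → κ v ≡ a₀ → col u ≡ col v) →
  (∀ v → κ v ≢ a₀ → InjectsBelow t (ColourClass col (col v))) →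
  ∀ i j → i ≢ j → InjectsBelow t (ColourClass col i) ⊎ InjectsBelow t (ColourClass col j)
injects-one-of-two {col = col} κ a₀ kept others i j i≢j
  with any? (λ u → (col u ≟ i) ×-dec (κ u ≟ a₀))
... | yes (u , cu≡i , κu≡a₀) = inj₂ (colourClass-injectsBelow others j
        λ cv≡j κv≡a₀ → i≢j (trans (sym cu≡i) (trans (kept κu≡a₀ κv≡a₀) cv≡j)))
... | no none = inj₁ (colourClass-injectsBelow others i λ cv≡i κv≡a₀ → none (_ , cv≡i , κv≡a₀))

keeping-independent-proper : ∀ {n c χ} (G : Graph n) {col : Fin n → Fin c} (κ : Fin n → Fin χ) a₀ →
  (∀ {u v} → κ u ≡ a₀ → κ v ≡ a₀ → ¬ Adj G u v) → Refines col κ →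
  (∀ v → κ v ≢ a₀ → InjectsBelow 1 (ColourClass col (col v))) → Proper G col
keeping-independent-proper G κ a₀ independent refines singletons {u} {v} adj same with κ u ≟ a₀
... | yes κu≡a₀ = independent κu≡a₀ (trans (sym (refines same)) κu≡a₀) adj
... | no  κu≢a₀ =
  irrefl G (subst (Adj G u) (sym (injectsBelow-1⇒unique (singletons u κu≢a₀) refl (sym same))) adj)

indicator : ∀ {n} → Subset n → Fin n → Fin 2
indicator S v = if lookup S v then zero else suc zero

indicator≡0⇒∈ : ∀ {n} (S : Subset n) {v} → indicator S v ≡ zero → v ∈ S
indicator≡0⇒∈ S {v} eq with lookup S v in look
... | true  = lookup⇒[]= v S look
... | false = contradiction eq λ ()

classSize-indicator : ∀ {n} (S : Subset n) → classSize (indicator S) zero ≡ ∣ S ∣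
classSize-indicator []          = refl
classSize-indicator (true  ∷ S) = cong suc (classSize-indicator S)
classSize-indicator (false ∷ S) = classSize-indicator S

largest : ∀ {k} (f : Fin (suc k) → ℕ) → ∃[ a ] ∀ b → f b ≤ f a
largest f = argmax f zero (allFin _) ,
            λ b → All.lookup (f[xs]≤f[argmax] {f = f} zero (allFin _)) (∈-allFin b)

largest-class-count : ∀ c j χ n s → c * suc j + s ≤ suc j + n + χ * j → n ≤ suc χ * s →
  c * (suc j * suc χ) ≤ n * χ + j * χ * suc χ + suc j * suc χ
largest-class-count c j χ n s count n≤ = +-cancelʳ-≤ n _ _ (begin
  c * (suc j * suc χ) + n               ≡⟨ cong (_+ n) (sym (*-assoc c (suc j) (suc χ))) ⟩
  c * suc j * suc χ + n                 ≤⟨ +-monoʳ-≤ _ (subst (n ≤_) (*-comm (suc χ) s) n≤) ⟩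
  c * suc j * suc χ + s * suc χ         ≡⟨ sym (*-distribʳ-+ (suc χ) (c * suc j) s) ⟩
  (c * suc j + s) * suc χ               ≤⟨ *-monoˡ-≤ (suc χ) count ⟩
  (suc j + n + χ * j) * suc χ           ≡⟨ rearrange j n χ ⟩
  n * χ + j * χ * suc χ + suc j * suc χ + n ∎)
  where
  open ≤-Reasoning
  rearrange : ∀ j n χ → (suc j + n + χ * j) * suc χ ≡ n * χ + j * χ * suc χ + suc j * suc χ + n
  rearrange = solve-∀

k₂≤k₁ : ∀ {h k₁ k₂} (H : Graph h) → IsK₁ H k₁ → IsK₂ H k₂ → k₂ ≤ k₁
k₂≤k₁ H (_ , X , bip , max≡k₁) (k₂≤min , _) =
  ≤-trans (k₂≤min X bip) (≤-trans (m⊓n≤m⊔n _ _) (≤-reflexive max≡k₁))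

HAvoidingWith : ∀ {h n} → Graph h → Graph n → (ℕ → Set) → Set
HAvoidingWith {n = n} H G P = ∃[ c ] (Σ (Fin n → Fin c) (HAvoiding H G) × P c)

DownwardClosed : (ℕ → Set) → Set
DownwardClosed P = ∀ {a b} → a ≤ b → P b → P a

module _ {h n} (H : Graph h) (G : Graph n) where

  both-bounds : ∀ {P Q : ℕ → Set} → DownwardClosed P → DownwardClosed Q →
    HAvoidingWith H G P → HAvoidingWith H G Q → HAvoidingWith H G (λ c → P c × Q c)
  both-bounds P↓ Q↓ (c₁ , col₁ , p) (c₂ , col₂ , q) with ≤-total c₁ c₂
  ... | inj₁ c₁≤c₂ = c₁ , col₁ , p , Q↓ c₁≤c₂ q
  ... | inj₂ c₂≤c₁ = c₂ , col₂ , P↓ c₂≤c₁ p , q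

  splitting-bound : ∀ {k₁ χ} → IsK₁ H k₁ → 2 ≤ k₁ → Σ (Fin n → Fin χ) (Proper G) →
    HAvoidingWith H G (λ c → c * (k₁ ∸ 1) ≤ n + (k₁ ∸ 2) * χ)
  splitting-bound {suc (suc k)} {χ} K₁ (s≤s (s≤s _)) (κ , κ-proper) with split-uniformly κ (suc k)
  ... | c , col , refines , small , count =
    c , (col , avoiding-k₁ H G (refines-proper G κ-proper refines) K₁ ≤-refl small) ,
    subst (λ m → c * suc k ≤ n + m) (*-comm χ k) count

  largest-class-bound : ∀ {k₂ χ} → IsK₂ H k₂ → 2 ≤ k₂ → Σ (Fin n → Fin χ) (Proper G) →
    HAvoidingWith H G (λ c → c * ((k₂ ∸ 1) * χ) ≤ n * (χ ∸ 1) + (k₂ ∸ 2) * (χ ∸ 1) * χ + (k₂ ∸ 1) * χ)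
  largest-class-bound {χ = zero} _ _ (κ , κ-proper) = 0 , (κ , κ-proper , λ ()) , z≤n
  largest-class-bound {suc (suc j)} {suc χ} K₂ (s≤s (s≤s _)) (κ , κ-proper) with largest (classSize κ)
  ... | a₀ , a₀-largest with split-keeping κ a₀ (suc j)
  ... | c , col , refines , kept , others , count =
    c , (col , avoiding-k₂ H G (refines-proper G κ-proper refines) K₂ ≤-refl
                 (injects-one-of-two κ a₀ kept others)) ,
    largest-class-count c j χ n (classSize κ a₀) count n≤
    where
    open ≤-Reasoning
    n≤ : n ≤ suc χ * classSize κ a₀
    n≤ = begin
      n                                  ≡⟨ sym (sum-classSize κ) ⟩
      sum (classSize κ)                  ≤⟨ sum-mono-≤ a₀-largest ⟩
      sum {suc χ} (λ _ → classSize κ a₀) ≡⟨ sum-const (suc χ) (classSize κ a₀) ⟩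
      suc χ * classSize κ a₀             ∎

  independent-set-bound : ∀ {α} → IsK₂ H 2 → ∃[ S ] (Independent G S × ∣ S ∣ ≡ α) →
    HAvoidingWith H G (λ c → c + α ≤ n + 1)
  independent-set-bound {α} K₂ (S , S-independent , ∣S∣≡α) with split-keeping (indicator S) zero 1
  ... | c , col , refines , kept , singletons , count =
    c , (col , avoiding-k₂ H G
                 (keeping-independent-proper G (indicator S) zero independent refines singletons)
                 K₂ ≤-refl (injects-one-of-two (indicator S) zero kept singletons)) ,
    (begin
      c + α                                ≡⟨ cong₂ _+_ (sym (*-identityʳ c)) size≡α ⟩
      c * 1 + classSize (indicator S) zero ≤⟨ count ⟩
      1 + n + 0                            ≡⟨ trans (+-identityʳ (1 + n)) (+-comm 1 n) ⟩
      n + 1                                ∎)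
    where
    open ≤-Reasoning
    size≡α : α ≡ classSize (indicator S) zero
    size≡α = sym (trans (classSize-indicator S) ∣S∣≡α)
    independent : ∀ {u v} → indicator S u ≡ zero → indicator S v ≡ zero → ¬ Adj G u v
    independent u∈ v∈ = S-independent (indicator≡0⇒∈ S u∈) (indicator≡0⇒∈ S v∈)

proposition1p10 : ∀ {h n} (H : Graph h) (G : Graph n) (k₁ k₂ χ α : ℕ) →
    IsK₁ H k₁ → IsK₂ H k₂ → IsChromaticNumber G χ → IsIndependenceNumber G α →
    (3 ≤ k₂ →
      ∃[ c ] (Σ (Fin n → Fin c) (HAvoiding H G)
        × c * (k₁ ∸ 1) ≤ n + (k₁ ∸ 2) * χ
        × c * ((k₂ ∸ 1) * χ) ≤ n * (χ ∸ 1) + (k₂ ∸ 2) * (χ ∸ 1) * χ + (k₂ ∸ 1) * χ))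
    × (k₂ ≡ 2 →
      ∃[ c ] (Σ (Fin n → Fin c) (HAvoiding H G)
        × c * (k₁ ∸ 1) ≤ n + (k₁ ∸ 2) * χ
        × c + α ≤ n + 1))
proposition1p10 H G k₁ k₂ χ α K₁ K₂ (κ , _) (S , _) =
  (λ 3≤k₂ → let 2≤k₂ = ≤-trans (n≤1+n 2) 3≤k₂ in
    both-bounds H G (*-bound↓ _ _) (*-bound↓ _ _)
      (splitting-bound H G K₁ (2≤k₁ 2≤k₂) κ) (largest-class-bound H G K₂ 2≤k₂ κ)) ,
  (λ { refl → both-bounds H G (*-bound↓ _ _) (+-bound↓ _ _)
      (splitting-bound H G K₁ (2≤k₁ ≤-refl) κ) (independent-set-bound H G K₂ S) })
  where
  2≤k₁ : 2 ≤ k₂ → 2 ≤ k₁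
  2≤k₁ 2≤k₂ = ≤-trans 2≤k₂ (k₂≤k₁ H K₁ K₂)
  *-bound↓ : ∀ x y → DownwardClosed (λ c → c * x ≤ y)
  *-bound↓ x y a≤b = ≤-trans (*-monoˡ-≤ x a≤b)
  +-bound↓ : ∀ x y → DownwardClosed (λ c → c + x ≤ y)
  +-bound↓ x y a≤b = ≤-trans (+-monoˡ-≤ x a≤b)
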